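{- Let $h\in\mathbb N$, $f:\mathbb N^{2h}\to\mathbb N$ primitive recursive, and $\Phi\equiv\exists x_1\forall y_1\cdots\exists x_h\forall y_h\,(f(x_1,\ldots,x_h,y_1,\ldots,y_h)=0)$ (quantifiers over $\mathbb N$). Then $\mathbb N\models\Phi$ if and only if $\{(\emptyset,\emptyset)\}\in\mathbb W^0_\Phi$.
   Context: A history is a set $H$ of $\exists$-positions $(\vec m_i,\vec n_i)$ with $0\le i\le h$ and $\vec m_i=(m_1,\ldots,m_i),\vec n_i=(n_1,\ldots,n_i)\in\mathbb N^i$; $(\emptyset,\emptyset)$ is the empty position. $\mathbb W^0_\Phi$ is the least set of histories such that: (Win) if some $(\vec m_h,\vec n_h)\in H$ satisfies $f(\vec m_h,\vec n_h)=0$, then $H\in\mathbb W^0_\Phi$; (Play) if for some $i<h$, $(\vec m_i,\vec n_i)\in H$ and $m\in\mathbb N$ we have $H\cup\{(\vec m_i\cdot m,\vec n_i\cdot n)\}\in\mathbb W^0_\Phi$ for all $n\in\mathbb N$, then $H\in\mathbb W^0_\Phi$ (where $\cdot$ appends an entry to a tuple). -}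

module Defs where

open import Data.Nat using (ℕ; zero; suc; _≤_; _<_)
open import Data.Nat.Properties using (≤-refl)
open import Data.Fin using (Fin)
open import Data.Vec using (Vec; []; _∷_; lookup; _++_; _∷ʳ_)
open import Data.Product using (Σ; _×_; _,_)
open import Data.List using (List; _∷_)
open import Data.List.Membership.Propositional using (_∈_)
open import Relation.Binary.PropositionalEquality using (_≡_)

mutual
  data PR : ℕ → Set where
    Z    : PR 0
    S    : PR 1
    P    : ∀ {k} → Fin k → PR k
    comp : ∀ {k l} → PR l → PRs k l → PR k
    rec  : ∀ {k} → PR k → PR (suc (suc k)) → PR (suc k)

  data PRs (k : ℕ) : ℕ → Set where
    []  : PRs k 0
    _∷_ : ∀ {l} → PR k → PRs k l → PRs k (suc l)

mutual
  eval : ∀ {k} → PR k → Vec ℕ k → ℕ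
  eval Z        _         = 0
  eval S        (x ∷ [])  = suc x
  eval (P i)    xs        = lookup xs i
  eval (comp g hs) xs     = eval g (evalAll hs xs)
  eval (rec g s) (n ∷ xs) = evalRec g s n xs

  evalRec : ∀ {k} → PR k → PR (suc (suc k)) → ℕ → Vec ℕ k → ℕ
  evalRec g s zero    xs = eval g xs
  evalRec g s (suc n) xs = eval s (n ∷ evalRec g s n xs ∷ xs)

  evalAll : ∀ {k l} → PRs k l → Vec ℕ k → Vec ℕ l
  evalAll []       xs = []
  evalAll (h ∷ hs) xs = eval h xs ∷ evalAll hs xs

Holds : (k : ℕ) → (Vec ℕ k → Vec ℕ k → Set) → Set
Holds zero    Q = Q [] []
Holds (suc k) Q = Σ ℕ λ x → (y : ℕ) → Holds k (λ xs ys → Q (x ∷ xs) (y ∷ ys))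

Sat : (h : ℕ) → PR (h Data.Nat.+ h) → Set
Sat h f = Holds h (λ xs ys → eval f (xs ++ ys) ≡ 0)

-- ∃-positions (m⃗ᵢ, n⃗ᵢ) with 0 ≤ i ≤ h, and histories (finite sets of
-- positions, represented as lists; only membership is ever used)

record Pos (h : ℕ) : Set where
  constructor pos
  field
    len  : ℕ
    len≤ : len ≤ h
    ms   : Vec ℕ len
    ns   : Vec ℕ len

History : ℕ → Set
History h = List (Pos h)

emptyPos : ∀ {h} → Pos h
emptyPos = pos 0 Data.Nat.z≤n [] []

data W {h : ℕ} (f : PR (h Data.Nat.+ h)) : History h → Set where
  win  : ∀ {H} (m n : Vec ℕ h) {p : h ≤ h} →
         pos h p m n ∈ H → eval f (m ++ n) ≡ 0 → W f H
  play : ∀ {H} {i : ℕ} (i<h : i < h) (m n : Vec ℕ i) {p : i ≤ h} →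
         pos i p m n ∈ H → (x : ℕ) →
         ((y : ℕ) → W f (pos (suc i) i<h (m ∷ʳ x) (n ∷ʳ y) ∷ H)) →
         W f H

module Submission where

-- Both sides of the equivalence talk about the same game:
-- ∃ picks x₁, ∀ answers y₁, …, and ∃ wins after h rounds iff f vanishes
-- on the play.  We make the game explicit by the inductive predicate
-- Wins Q i m n, "∃ has a well-founded winning strategy from the position
-- (m, n) of length i" for an arbitrary goal Q on complete plays.
--
--  * Wins Q 0 [] [] is equivalent to the quantifier prefix Holds h Q
--    (holds⇔wins); a position (x ∷ m, y ∷ n) of the game for Q is a
--    position (m, n) of the game for Q with x, y fixed (shift lemmas).
--  * For Q = "f vanishes", a history containing a winning position lies
--    in 𝕎⁰_Φ (winning⇒W): the strategy tree is literally a derivation.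
--  * Conversely, every history in 𝕎⁰_Φ contains a winning position
--    (W⇒winning).  This direction is classical: in the Play step either
--    some answer y leads to a history whose winning position was already
--    in H, or every answer makes the new position winning.

open import Defs
open import Data.Nat using (ℕ)
open import Data.List using (List; _∷_; [])
open import Function.Bundles using (_⇔_)
open import Axiom.ExcludedMiddle using (ExcludedMiddle)
open import Level using (0ℓ)

open import Data.Nat using (suc; _+_; _≤_; _<_; s≤s; s≤s⁻¹; z≤n)
open import Data.Vec using (Vec; []; _∷_; _++_; _∷ʳ_)
open import Data.Product using (Σ; _×_; _,_)
open import Data.List.Membership.Propositional using (_∈_)
open import Data.List.Relation.Unary.Any using (here; there)
open import Relation.Nullary using (yes; no)
open import Relation.Nullary.Negation using (contradiction)
open import Relation.Binary.PropositionalEquality using (_≡_; refl)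
open import Function.Bundles using (mk⇔; Equivalence)

data Wins {h : ℕ} (Q : Vec ℕ h → Vec ℕ h → Set) :
          (i : ℕ) → Vec ℕ i → Vec ℕ i → Set where
  done : ∀ m n → Q m n → Wins Q h m n
  move : ∀ {i m n} → i < h → (x : ℕ) →
         ((y : ℕ) → Wins Q (suc i) (m ∷ʳ x) (n ∷ʳ y)) → Wins Q i m n

module _ {k : ℕ} {Q : Vec ℕ (suc k) → Vec ℕ (suc k) → Set} (x y : ℕ) where

  private
    Qxy : Vec ℕ k → Vec ℕ k → Set
    Qxy m n = Q (x ∷ m) (y ∷ n)

  shiftIn : ∀ {i m n} → Wins Qxy i m n → Wins Q (suc i) (x ∷ m) (y ∷ n)
  shiftIn (done m n q)    = done (x ∷ m) (y ∷ n) q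
  shiftIn (move i<k x′ g) = move (s≤s i<k) x′ (λ y′ → shiftIn (g y′))

  shiftOut : ∀ {i m n} → Wins Q (suc i) (x ∷ m) (y ∷ n) → Wins Qxy i m n
  shiftOut (done _ _ q)    = done _ _ q
  shiftOut (move i<k x′ g) = move (s≤s⁻¹ i<k) x′ (λ y′ → shiftOut (g y′))

holds⇔wins : ∀ h (Q : Vec ℕ h → Vec ℕ h → Set) → Holds h Q ⇔ Wins Q 0 [] []
holds⇔wins h Q = mk⇔ (toWins h Q) (fromWins h Q)
  where
  toWins : ∀ h (Q : Vec ℕ h → Vec ℕ h → Set) → Holds h Q → Wins Q 0 [] []
  toWins 0       Q q       = done [] [] q
  toWins (suc k) Q (x , r) =
    move (s≤s z≤n) x (λ y → shiftIn x y (toWins k _ (r y)))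

  fromWins : ∀ h (Q : Vec ℕ h → Vec ℕ h → Set) → Wins Q 0 [] [] → Holds h Q
  fromWins 0       Q (done _ _ q)  = q
  fromWins (suc k) Q (move _ x g) = x , λ y → fromWins k _ (shiftOut x y (g y))

module _ {h : ℕ} (f : PR (h + h)) where

  Vanishes : Vec ℕ h → Vec ℕ h → Set
  Vanishes m n = eval f (m ++ n) ≡ 0

  WinningHistory : History h → Set
  WinningHistory H =
    Σ (Pos h) λ q → q ∈ H × Wins Vanishes (Pos.len q) (Pos.ms q) (Pos.ns q)

  winning⇒W : ∀ {i m n} {p : i ≤ h} {H : History h} →
              Wins Vanishes i m n → pos i p m n ∈ H → W f H
  winning⇒W (done m n q)   mem = win m n mem q
  winning⇒W (move i<h x g) mem =
    play i<h _ _ mem x (λ y → winning⇒W (g y) (here refl))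

  W⇒winning : ExcludedMiddle 0ℓ → ∀ {H} → W f H → WinningHistory H
  W⇒winning em (win m n {p} mem q) = pos h p m n , mem , done m n q
  W⇒winning em {H} (play i<h m n {p} mem x g) with em {WinningHistory H}
  ... | yes winningH = winningH
  ... | no ¬winningH = pos _ p m n , mem , move i<h x newWins
    where
    -- Since H itself is not winning, the winning position found after
    -- each answer y must be the newly added one.
    newWins : ∀ y → Wins Vanishes _ (m ∷ʳ x) (n ∷ʳ y)
    newWins y with W⇒winning em (g y)
    ... | _ , here refl  , wins = wins
    ... | q , there q∈H , wins = contradiction (q , q∈H , wins) ¬winningH

mainTheorem5 : ExcludedMiddle 0ℓ → (h : ℕ) (f : PR (h Data.Nat.+ h)) →
    Sat h f ⇔ W {h} f (emptyPos {h} ∷ [])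
mainTheorem5 em h f = mk⇔ sat⇒W W⇒sat
  where
  open Equivalence (holds⇔wins h (Vanishes f)) using (to; from)

  sat⇒W : Sat h f → W f (emptyPos ∷ [])
  sat⇒W sat = winning⇒W f (to sat) (here refl)

  W⇒sat : W f (emptyPos ∷ []) → Sat h f
  W⇒sat w with W⇒winning f em w
  ... | _ , here refl , wins = from wins
  ... | _ , there ()  , _
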